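{- Let $w=\mu^{\omega}(a)$ where $\mu$ is an injective $r$-uniform morphism ($r\ge 2$) prolongable on the letter $a$, and suppose $w$ is eventually periodic. Then the period of $w$ is not divisible by $r$.
   Context: A morphism $\mu$ of $A^{\infty}$ ($A$ a finite alphabet) satisfies $\mu(uv)=\mu(u)\mu(v)$ for finite $u$; it is $r$-uniform if $|\mu(b)|=r$ for every letter $b$, and prolongable on $a$ if $\mu(a)$ begins with $a$; $\mu^{\omega}(a)$ is the infinite word having each $\mu^n(a)$ as a prefix. An infinite word $w=w_0w_1\cdots$ is eventually periodic if deleting some finite number of initial letters yields a periodic word; its period is the least $p\ge1$ such that $w_{j+p}=w_j$ for all sufficiently large $j$. -}

module Defs where

open import Data.Nat using (ℕ; zero; suc; _+_; _≤_; _≥_)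
open import Data.Fin using (Fin; toℕ)
open import Data.List using (List; []; _∷_; length; lookup; concatMap; [_])
open import Data.Product using (Σ; ∃; _×_)
open import Relation.Binary.PropositionalEquality using (_≡_)
open import Function.Definitions using (Injective)

-- A morphism of A^∞ over the finite alphabet A = Fin k is determined by the
-- images of the letters; this is its extension to finite words.
extend : ∀ {k} → (Fin k → List (Fin k)) → List (Fin k) → List (Fin k)
extend μ = concatMap μ

iter : ∀ {k} → (Fin k → List (Fin k)) → ℕ → List (Fin k) → List (Fin k)
iter μ zero    u = u
iter μ (suc n) u = extend μ (iter μ n u)

Uniform : ∀ {k} → (Fin k → List (Fin k)) → ℕ → Set
Uniform μ r = ∀ b → length (μ b) ≡ r

InjectiveMorphism : ∀ {k} → (Fin k → List (Fin k)) → Set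
InjectiveMorphism μ = Injective _≡_ _≡_ (extend μ)

Prolongable : ∀ {k} → (Fin k → List (Fin k)) → Fin k → Set
Prolongable {k} μ a = Σ (List (Fin k)) λ t → μ a ≡ a ∷ t

Word : ℕ → Set
Word k = ℕ → Fin k

IsPrefix : ∀ {k} → List (Fin k) → Word k → Set
IsPrefix u w = ∀ (i : Fin (length u)) → lookup u i ≡ w (toℕ i)

-- w = μ^ω(a): every μ^n(a) is a prefix of w
IsFixedPointWord : ∀ {k} → (Fin k → List (Fin k)) → Fin k → Word k → Set
IsFixedPointWord μ a w = ∀ n → IsPrefix (iter μ n [ a ]) w

EventualPeriod : ∀ {k} → Word k → ℕ → Set
EventualPeriod w p = (p ≥ 1) × ∃ λ N → ∀ j → N ≤ j → w (j + p) ≡ w j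

EventuallyPeriodic : ∀ {k} → Word k → Set
EventuallyPeriodic w = ∃ λ p → EventualPeriod w p

IsPeriod : ∀ {k} → Word k → ℕ → Set
IsPeriod w p = EventualPeriod w p × (∀ q → EventualPeriod w q → p ≤ q)

-- Since w is a fixed
-- point of μ, letter i of w is expanded by μ into the block
--   μ(w_i) = w_{ir} w_{ir+1} ⋯ w_{ir+r-1}.
-- Suppose w has an eventual period of the form qr (beyond the threshold N).
-- For j ≥ N the blocks μ(w_{j+q}) and μ(w_j) occupy positions (j+q)r+t and
-- jr+t, which differ by qr and lie beyond N, so the blocks coincide; as μ is
-- injective, w_{j+q} = w_j.  Hence q is itself an eventual period, and q < qr
-- because r ≥ 2: a period divisible by r is never the least one.
module Submission where

open import Defs
open import Data.Nat using (ℕ; _≥_)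
open import Data.Nat.Divisibility using (_∣_)
open import Data.Fin using (Fin)
open import Data.List using (List)
open import Relation.Nullary using (¬_)

open import Data.Nat using (zero; suc; _+_; _*_; _^_; _≤_; _<_; z≤n; s≤s; NonZero; >-nonZero)
open import Data.Nat.Properties
open import Data.Nat.Divisibility using (divides)
open import Data.Nat.Tactic.RingSolver using (solve-∀)
open import Data.Fin as F using ()
open import Data.List using ([]; _∷_; _++_; length; [_])
open import Data.List.Properties using (length-++; ++-identityʳ; ∷-injectiveˡ)
open import Data.Maybe using (Maybe; just; nothing; _>>=_)
open import Data.Product using (_,_)
open import Relation.Binary.PropositionalEquality hiding ([_])

infixl 9 _!_
_!_ : ∀ {A : Set} → List A → ℕ → Maybe A
[] ! _ = nothing
(x ∷ xs) ! zero = just x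
(x ∷ xs) ! suc n = xs ! n

prefix-! : ∀ {k} (u : List (Fin k)) (w : Word k) → IsPrefix u w →
  ∀ j → j < length u → u ! j ≡ just (w j)
prefix-! (x ∷ u) w P zero _ = cong just (P F.zero)
prefix-! (x ∷ u) w P (suc j) (s≤s j<) =
  prefix-! u (λ n → w (suc n)) (λ i → P (F.suc i)) j j<

++-!ˡ : ∀ {A : Set} (xs ys : List A) t → t < length xs → (xs ++ ys) ! t ≡ xs ! t
++-!ˡ (x ∷ xs) ys zero _ = refl
++-!ˡ (x ∷ xs) ys (suc t) (s≤s t<) = ++-!ˡ xs ys t t<

++-!ʳ : ∀ {A : Set} (xs ys : List A) m → (xs ++ ys) ! (length xs + m) ≡ ys ! m
++-!ʳ [] ys m = refl
++-!ʳ (x ∷ xs) ys m = ++-!ʳ xs ys m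

!-extensionality : ∀ {A : Set} (xs ys : List A) → length xs ≡ length ys →
  (∀ t → t < length xs → xs ! t ≡ ys ! t) → xs ≡ ys
!-extensionality [] [] _ _ = refl
!-extensionality (x ∷ xs) (y ∷ ys) len agree with agree zero (s≤s z≤n)
... | refl = cong (x ∷_)
  (!-extensionality xs ys (suc-injective len) (λ t t< → agree (suc t) (s≤s t<)))

-- Exponentials with base r ≥ 2 outgrow the exponent; this guarantees that
-- μ^i(a), of length r^i, already contains position i of w.
n<r^n : ∀ r → 2 ≤ r → ∀ n → n < r ^ n
n<r^n r r≥2 zero = s≤s z≤n
n<r^n r r≥2 (suc n) = begin-strict
    suc n
  ≤⟨ n<r^n r r≥2 n ⟩
    r ^ n
  <⟨ m<m*n (r ^ n) r r≥2 ⟩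
    r ^ n * r
  ≡⟨ *-comm (r ^ n) r ⟩
    r * r ^ n
  ∎
  where
  open ≤-Reasoning
  instance
    r^n≢0 : NonZero (r ^ n)
    r^n≢0 = >-nonZero (≤-trans (s≤s z≤n) (n<r^n r r≥2 n))

module UniformMorphism {k} (μ : Fin k → List (Fin k)) (r : ℕ) (uniform : Uniform μ r) where

  extend-! : ∀ (u : List (Fin k)) i t → t < r →
    extend μ u ! (i * r + t) ≡ (u ! i >>= λ b → μ b ! t)
  extend-! [] i t t<r = refl
  extend-! (x ∷ u) zero t t<r =
    ++-!ˡ (μ x) (extend μ u) t (subst (t <_) (sym (uniform x)) t<r)
  extend-! (x ∷ u) (suc i) t t<r = begin
      (μ x ++ extend μ u) ! (r + i * r + t)
    ≡⟨ cong (λ n → (μ x ++ extend μ u) ! n) (+-assoc r (i * r) t) ⟩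
      (μ x ++ extend μ u) ! (r + (i * r + t))
    ≡⟨ cong (λ m → (μ x ++ extend μ u) ! (m + (i * r + t))) (sym (uniform x)) ⟩
      (μ x ++ extend μ u) ! (length (μ x) + (i * r + t))
    ≡⟨ ++-!ʳ (μ x) (extend μ u) (i * r + t) ⟩
      extend μ u ! (i * r + t)
    ≡⟨ extend-! u i t t<r ⟩
      (u ! i >>= λ b → μ b ! t)
    ∎
    where open ≡-Reasoning

  length-extend : ∀ (u : List (Fin k)) → length (extend μ u) ≡ length u * r
  length-extend [] = refl
  length-extend (x ∷ u) = trans (length-++ (μ x)) (cong₂ _+_ (uniform x) (length-extend u))

  length-iter : ∀ n (u : List (Fin k)) → length (iter μ n u) ≡ length u * r ^ n
  length-iter zero u = sym (*-identityʳ _)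
  length-iter (suc n) u = begin
      length (extend μ (iter μ n u))
    ≡⟨ length-extend (iter μ n u) ⟩
      length (iter μ n u) * r
    ≡⟨ cong (_* r) (length-iter n u) ⟩
      length u * r ^ n * r
    ≡⟨ *-assoc (length u) (r ^ n) r ⟩
      length u * (r ^ n * r)
    ≡⟨ cong (length u *_) (*-comm (r ^ n) r) ⟩
      length u * r ^ suc n
    ∎
    where open ≡-Reasoning

image-block : ∀ {k} (μ : Fin k → List (Fin k)) (r : ℕ) (a : Fin k) (w : Word k) →
  r ≥ 2 → Uniform μ r → IsFixedPointWord μ a w →
  ∀ i t → t < r → μ (w i) ! t ≡ just (w (i * r + t))
image-block μ r a w r≥2 uniform fixed i t t<r = let open ≡-Reasoning in begin
    μ (w i) ! t
  ≡⟨ cong (_>>= λ b → μ b ! t) (sym u!i) ⟩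
    (u ! i >>= λ b → μ b ! t)
  ≡⟨ sym (extend-! u i t t<r) ⟩
    extend μ u ! (i * r + t)
  ≡⟨ prefix-! (extend μ u) w (fixed (suc i)) (i * r + t) inside ⟩
    just (w (i * r + t))
  ∎
  where
  open UniformMorphism μ r uniform
  u = iter μ i [ a ]
  i<|u| : i < length u
  i<|u| = subst (i <_) (sym (trans (length-iter i [ a ]) (*-identityˡ _))) (n<r^n r r≥2 i)
  u!i : u ! i ≡ just (w i)
  u!i = prefix-! u w (fixed i) i i<|u|
  inside : i * r + t < length (extend μ u)
  inside = begin-strict
      i * r + t
    <⟨ +-monoʳ-< (i * r) t<r ⟩
      i * r + r
    ≡⟨ +-comm (i * r) r ⟩
      suc i * r
    ≤⟨ *-monoˡ-≤ r i<|u| ⟩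
      length u * r
    ≡⟨ sym (length-extend u) ⟩
      length (extend μ u)
    ∎
    where open ≤-Reasoning

-- Moving q letters forward moves the corresponding r-blocks qr positions forward.
shift-by-blocks : ∀ j q r t → (j + q) * r + t ≡ (j * r + t) + q * r
shift-by-blocks = solve-∀

letter-injective : ∀ {k} (μ : Fin k → List (Fin k)) → InjectiveMorphism μ →
  ∀ {b c} → μ b ≡ μ c → b ≡ c
letter-injective μ injective {b} {c} μb≡μc = ∷-injectiveˡ (injective {[ b ]} {[ c ]}
  (trans (++-identityʳ (μ b)) (trans μb≡μc (sym (++-identityʳ (μ c))))))

period-descends : ∀ {k} (μ : Fin k → List (Fin k)) (r : ℕ) (a : Fin k) (w : Word k) →
  r ≥ 2 → Uniform μ r → InjectiveMorphism μ → IsFixedPointWord μ a w →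
  ∀ q → EventualPeriod w (q * r) → EventualPeriod w q
period-descends μ r a w r≥2 uniform injective fixed zero (() , _)
period-descends μ r a w r≥2 uniform injective fixed q@(suc _) (_ , N , periodic) =
  s≤s z≤n , N , λ j N≤j → letter-injective μ injective (same-block j N≤j)
  where
  instance
    r≢0 : NonZero r
    r≢0 = >-nonZero (≤-trans (s≤s z≤n) r≥2)
  block : ∀ i t → t < r → μ (w i) ! t ≡ just (w (i * r + t))
  block = image-block μ r a w r≥2 uniform fixed
  -- beyond N, the blocks of w_{j+q} and w_j are factors of w that are qr apart
  same-block : ∀ j → N ≤ j → μ (w (j + q)) ≡ μ (w j)
  same-block j N≤j = !-extensionality _ _ (trans (uniform _) (sym (uniform _))) λ t t< →
    let t<r = subst (t <_) (uniform _) t< in begin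
      μ (w (j + q)) ! t
    ≡⟨ block (j + q) t t<r ⟩
      just (w ((j + q) * r + t))
    ≡⟨ cong (λ n → just (w n)) (shift-by-blocks j q r t) ⟩
      just (w ((j * r + t) + q * r))
    ≡⟨ cong just (periodic (j * r + t) (≤-trans N≤j (≤-trans (m≤m*n j r) (m≤m+n (j * r) t)))) ⟩
      just (w (j * r + t))
    ≡⟨ sym (block j t t<r) ⟩
      μ (w j) ! t
    ∎
    where open ≡-Reasoning

lemma10 : ∀ {k} (μ : Fin k → List (Fin k)) (r : ℕ) (a : Fin k) (w : Word k) →
    r ≥ 2 → Uniform μ r → InjectiveMorphism μ → Prolongable μ a →
    IsFixedPointWord μ a w → EventuallyPeriodic w →
    ∀ p → IsPeriod w p → ¬ (r ∣ p)
lemma10 μ r a w r≥2 uniform injective _ fixed _ p (period , least) (divides q p≡qr) =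
  <⇒≱ q<qr (subst (_≤ q) p≡qr (least q q-period))
  where
  q-period : EventualPeriod w q
  q-period = period-descends μ r a w r≥2 uniform injective fixed q
    (subst (EventualPeriod w) p≡qr period)
  q<qr : q < q * r
  q<qr with q-period
  ... | q≥1 , _ = m<m*n q r {{>-nonZero q≥1}} r≥2
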